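{- Let $G$ be a connected cubic graph without semi-edges which does not contain a perfect matching. Then every inclusion-wise minimal good set of vertices of $G$ is very good.
   Context: A graph has finite vertex and edge sets; every edge is a normal edge (two distinct end-vertices, adding 1 to each degree) or a loop (one vertex, adding 2 to its degree) (semi-edges are also possible in general but are excluded here); multiple loops and parallel normal edges are allowed. Cubic means every vertex has degree 3. A perfect matching is a set of normal edges such that each vertex is incident with exactly one of them. For $X\subseteq V(G)$, $c_{odd}(G-X)$ is the number of connected components of $G-X$ with an odd number of vertices. $X$ is good if $c_{odd}(G-X)>|X|$. $X$ is very good if it is good, the induced subgraph $G[X]$ has no loops nor multiple edges, and no multiple edge is incident with one vertex of $X$ and one vertex of $V(G)\setminus X$ (equivalently, every loop and every multiple edge of $G$ is incident only with vertices of $V(G)\setminus X$). -}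

module Defs where

open import Data.Nat using (ℕ; zero; suc; _+_; _<_; _≤ᵇ_)
open import Data.Nat.Base using () renaming (_≡ᵇ_ to _=ℕ_)
open import Data.Bool using (Bool; true; false; _∧_; _∨_; not; if_then_else_)
open import Data.Fin using (Fin; zero; suc; toℕ)
open import Data.Fin.Properties using (_≟_)
open import Data.Fin.Subset using (Subset; ∣_∣; _⊂_; _∉_)
open import Data.Vec using (lookup)
open import Data.Product using (_×_; _,_; proj₁; proj₂; Σ)
open import Relation.Nullary using (¬_)
open import Relation.Nullary.Decidable using (⌊_⌋)
open import Relation.Binary.PropositionalEquality using (_≡_; _≢_)

-- A finite multigraph (loops and parallel edges allowed, no semi-edges):
-- vertices Fin n, edges Fin m, each edge has an (ordered, but the order is
-- irrelevant) pair of end-vertices; it is a loop iff both ends coincide.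
record Graph : Set where
  field
    n    : ℕ
    m    : ℕ
    ends : Fin m → Fin n × Fin n

open Graph public

sumF : ∀ {k} → (Fin k → ℕ) → ℕ
sumF {zero}  f = 0
sumF {suc k} f = f zero + sumF (λ i → f (suc i))

anyF : ∀ {k} → (Fin k → Bool) → Bool
anyF {zero}  f = false
anyF {suc k} f = f zero ∨ anyF (λ i → f (suc i))

allF : ∀ {k} → (Fin k → Bool) → Bool
allF {zero}  f = true
allF {suc k} f = f zero ∧ allF (λ i → f (suc i))

ind : Bool → ℕ
ind b = if b then 1 else 0

_==_ : ∀ {k} → Fin k → Fin k → Bool
u == v = ⌊ u ≟ v ⌋

module _ (G : Graph) where

  src tgt : Fin (m G) → Fin (n G)
  src e = proj₁ (ends G e)
  tgt e = proj₂ (ends G e)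

  IsLoop : Fin (m G) → Set
  IsLoop e = src e ≡ tgt e

  -- degree: a normal edge adds 1 to each end, a loop adds 2 to its vertex
  degree : Fin (n G) → ℕ
  degree v = sumF (λ e → ind (src e == v) + ind (tgt e == v))

  Cubic : Set
  Cubic = ∀ v → degree v ≡ 3

  IsPerfectMatching : (Fin (m G) → Bool) → Set
  IsPerfectMatching M =
    (∀ e → M e ≡ true → ¬ IsLoop e) ×
    (∀ v → sumF (λ e → ind (M e ∧ (src e == v ∨ tgt e == v))) ≡ 1)

  HasPerfectMatching : Set
  HasPerfectMatching = Σ (Fin (m G) → Bool) IsPerfectMatching

  inX : Subset (n G) → Fin (n G) → Bool
  inX X v = lookup X v

  adj : Subset (n G) → Fin (n G) → Fin (n G) → Bool
  adj X u v = not (inX X u) ∧ not (inX X v) ∧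
    anyF (λ e → (src e == u ∧ tgt e == v) ∨ (src e == v ∧ tgt e == u))

  reach : Subset (n G) → ℕ → Fin (n G) → Fin (n G) → Bool
  reach X zero    u v = (u == v) ∧ not (inX X u)
  reach X (suc k) u v = reach X k u v ∨ anyF (λ w → reach X k u w ∧ adj X w v)

  -- u and v lie in the same connected component of G - X
  -- (walks of length ≤ |V(G)| suffice)
  sameComp : Subset (n G) → Fin (n G) → Fin (n G) → Bool
  sameComp X = reach X (n G)

  Connected : Set
  Connected = ∀ u v → sameComp Data.Fin.Subset.⊥ u v ≡ true

  compSize : Subset (n G) → Fin (n G) → ℕ
  compSize X v = sumF (λ w → ind (sameComp X v w))

  isOdd : ℕ → Bool
  isOdd zero = false
  isOdd (suc k) = not (isOdd k)

  -- v is the representative (least-index vertex) of its component of G - X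
  isRep : Subset (n G) → Fin (n G) → Bool
  isRep X v = not (inX X v) ∧
    allF (λ w → not (sameComp X v w) ∨ (toℕ v ≤ᵇ toℕ w))

  cOdd : Subset (n G) → ℕ
  cOdd X = sumF (λ v → ind (isRep X v ∧ isOdd (compSize X v)))

  Good : Subset (n G) → Set
  Good X = ∣ X ∣ < cOdd X

  MinimalGood : Subset (n G) → Set
  MinimalGood X = Good X × (∀ Y → Y ⊂ X → ¬ Good Y)

  Parallel : Fin (m G) → Fin (m G) → Set
  Parallel e e' = e ≢ e' × ¬ IsLoop e ×
    ((src e ≡ src e' × tgt e ≡ tgt e') ⊎' (src e ≡ tgt e' × tgt e ≡ src e'))
    where
      open import Data.Sum using () renaming (_⊎_ to _⊎'_)

  VeryGood : Subset (n G) → Set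
  VeryGood X = Good X ×
    (∀ e → IsLoop e → src e ∉ X) ×
    (∀ e e' → Parallel e e' → (src e ∉ X × tgt e ∉ X))

{-# OPTIONS --safe #-}

-- Let x ∈ X lie on two parallel edges xy, or on a loop (then put y = x). As x has degree 3, all its
-- neighbours other than x and y coincide, say with b. Putting x back into the graph therefore only
-- merges x with the components of G - X containing y and b; if these are distinct and both odd, the
-- merged component is odd again. So c_odd drops by at most one while |X| drops by one: X - x is still
-- good, contradicting the minimality of X.

module Submission where

open import Defs
open import Data.Fin.Subset using (Subset)
open import Relation.Nullary using (¬_)

import Algebra.Properties.CommutativeSemigroup
open import Data.Bool using (Bool; true; false; _∧_; _∨_; not; _xor_)
import Data.Bool.Properties as Bool
open import Data.Bool.Properties using (∧-conicalˡ; ∧-conicalʳ; ¬-not; ∨-zeroʳ; not-distribˡ-xor; T-≡)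
open import Data.Empty using (⊥-elim)
open import Data.Fin using (Fin; zero; suc; toℕ)
open import Data.Fin.Properties using (_≟_; suc-injective; toℕ-injective; any?)
open import Data.Fin.Subset using (_-_; _∈_; _∉_)
open import Data.Fin.Subset.Properties using (p─⊥≡p; x∈p⇒∣p-x∣<∣p∣; x∈p⇒p-x⊂p)
open import Data.List using (List; []; _∷_; map)
open import Data.List.Properties using (map-cong-local)
open import Data.List.Relation.Unary.All as All using (All; []; _∷_)
open import Data.List.Relation.Unary.Unique.Propositional using (Unique; []; _∷_)
open import Data.Nat using (ℕ; zero; suc; _+_; _≤_; _<_; z≤n; s≤s)
open import Data.Nat.ListAction using (sum)
open import Data.Nat.Properties
  using ( ≤-trans; ≤-reflexive; ≤-antisym; ≤-pred; <-irrefl; m≤m+n; m≤n+m; m≤n⇒m≤1+n; ≤ᵇ⇒≤; ≤⇒≤ᵇ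
        ; +-comm; +-suc; +-identityʳ; +-mono-≤; +-monoˡ-≤; +-monoʳ-≤; +-mono-<-≤; +-mono-≤-<
        ; +-commutativeSemigroup; module ≤-Reasoning)
open import Data.Product using (_×_; _,_; proj₁; proj₂; ∃-syntax)
open import Data.Sum using (_⊎_; inj₁; inj₂; [_,_]′)
open import Data.Vec using (_∷_; lookup)
open import Data.Vec.Properties using ([]=⇒lookup)
open import Function using (Equivalence; _∘_)
open import Relation.Binary.PropositionalEquality
open import Relation.Nullary using (Dec; yes; no; ¬?)
open import Relation.Nullary.Decidable using (_×-dec_; toWitness; fromWitness)
open import Relation.Unary using (Decidable)

open Algebra.Properties.CommutativeSemigroup +-commutativeSemigroup
  using (x∙yz≈y∙xz; interchange)

≡true⇒≢false : ∀ {b} → b ≡ true → b ≢ false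
≡true⇒≢false refl ()

not≡true⇒≡false : ∀ {b} → not b ≡ true → b ≡ false
not≡true⇒≡false {false} _ = refl

≡false⇒not≡true : ∀ {b} → b ≡ false → not b ≡ true
≡false⇒not≡true refl = refl

∨≡true⁺ˡ : ∀ {a} b → a ≡ true → a ∨ b ≡ true
∨≡true⁺ˡ b refl = refl

∨≡true⁺ʳ : ∀ a {b} → b ≡ true → a ∨ b ≡ true
∨≡true⁺ʳ a refl = ∨-zeroʳ a

∨≡true⁻ : ∀ a {b} → a ∨ b ≡ true → a ≡ true ⊎ b ≡ true
∨≡true⁻ true  _ = inj₁ refl
∨≡true⁻ false p = inj₂ p

∧≡true⁺ : ∀ {a b} → a ≡ true → b ≡ true → a ∧ b ≡ true
∧≡true⁺ refl refl = refl

∧≡true⁻ : ∀ a {b} → a ∧ b ≡ true → a ≡ true × b ≡ true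
∧≡true⁻ a ab = ∧-conicalˡ a _ ab , ∧-conicalʳ a _ ab

not-∨≡true⁺ : ∀ a {b} → (a ≡ true → b ≡ true) → not a ∨ b ≡ true
not-∨≡true⁺ true  a⇒b = a⇒b refl
not-∨≡true⁺ false _   = refl

not-∨≡true⁻ : ∀ a {b} → not a ∨ b ≡ true → a ≡ true → b ≡ true
not-∨≡true⁻ true nab refl = nab

not-∨≡false⁻ : ∀ a b → not a ∨ b ≡ false → a ≡ true × b ≡ false
not-∨≡false⁻ true false _ = refl , refl

≡true-ext : ∀ {a b} → (a ≡ true → b ≡ true) → (b ≡ true → a ≡ true) → a ≡ b
≡true-ext {true}          to _    = sym (to refl)
≡true-ext {false} {true}  _  from = from refl
≡true-ext {false} {false} _  _    = refl

ind-∨-disjoint : ∀ a b → (a ≡ true → b ≡ false) → ind (a ∨ b) ≡ ind a + ind b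
ind-∨-disjoint true  b a⇒¬b = cong (λ c → suc (ind c)) (sym (a⇒¬b refl))
ind-∨-disjoint false b _    = refl

ind-split : ∀ a b → ind b ≡ ind (a ∧ b) + ind (not a ∧ b)
ind-split true  b = sym (+-identityʳ (ind b))
ind-split false b = refl

==⇒≡ : ∀ {k} {u v : Fin k} → (u == v) ≡ true → u ≡ v
==⇒≡ {u = u} {v} p = toWitness {a? = u ≟ v} (Equivalence.from T-≡ p)

≡⇒== : ∀ {k} {u v : Fin k} → u ≡ v → (u == v) ≡ true
≡⇒== {u = u} {v} u≡v = Equivalence.to T-≡ (fromWitness {a? = u ≟ v} u≡v)

anyF⁺ : ∀ {k} (p : Fin k → Bool) i → p i ≡ true → anyF p ≡ true
anyF⁺ p zero    pi = ∨≡true⁺ˡ _ pi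
anyF⁺ p (suc i) pi = ∨≡true⁺ʳ (p zero) (anyF⁺ (λ j → p (suc j)) i pi)

anyF⁻ : ∀ {k} (p : Fin k → Bool) → anyF p ≡ true → ∃[ i ] p i ≡ true
anyF⁻ {suc k} p any with ∨≡true⁻ (p zero) any
... | inj₁ p0 = zero , p0
... | inj₂ rest with anyF⁻ (λ j → p (suc j)) rest
...   | i , pi = suc i , pi

allF⁺ : ∀ {k} (p : Fin k → Bool) → (∀ i → p i ≡ true) → allF p ≡ true
allF⁺ {zero}  p _   = refl
allF⁺ {suc k} p all = ∧≡true⁺ (all zero) (allF⁺ (λ j → p (suc j)) (λ j → all (suc j)))

allF⁻ : ∀ {k} (p : Fin k → Bool) → allF p ≡ true → ∀ i → p i ≡ true
allF⁻ {suc k} p all zero    = ∧-conicalˡ (p zero) _ all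
allF⁻ {suc k} p all (suc i) = allF⁻ (λ j → p (suc j)) (∧-conicalʳ (p zero) _ all) i

allF-false⇒∃false : ∀ {k} (p : Fin k → Bool) → allF p ≡ false → ∃[ i ] p i ≡ false
allF-false⇒∃false {suc k} p all with p zero in p0
... | false = zero , p0
... | true with allF-false⇒∃false (λ j → p (suc j)) all
...   | i , pi = suc i , pi

allF-cong : ∀ {k} {p q : Fin k → Bool} → (∀ i → p i ≡ q i) → allF p ≡ allF q
allF-cong {zero}  _   = refl
allF-cong {suc k} p≗q = cong₂ _∧_ (p≗q zero) (allF-cong (λ j → p≗q (suc j)))

sumF-cong : ∀ {k} {f g : Fin k → ℕ} → (∀ i → f i ≡ g i) → sumF f ≡ sumF g
sumF-cong {zero}  _   = refl
sumF-cong {suc k} f≗g = cong₂ _+_ (f≗g zero) (sumF-cong (λ j → f≗g (suc j)))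

sumF-distrib-+ : ∀ {k} (f g : Fin k → ℕ) → sumF (λ i → f i + g i) ≡ sumF f + sumF g
sumF-distrib-+ {zero}  f g = refl
sumF-distrib-+ {suc k} f g =
  trans (cong (f zero + g zero +_) (sumF-distrib-+ (λ j → f (suc j)) (λ j → g (suc j))))
        (interchange (f zero) (g zero) _ _)

sumF-mono-≤ : ∀ {k} {f g : Fin k → ℕ} → (∀ i → f i ≤ g i) → sumF f ≤ sumF g
sumF-mono-≤ {zero}  _   = z≤n
sumF-mono-≤ {suc k} f≤g = +-mono-≤ (f≤g zero) (sumF-mono-≤ (λ j → f≤g (suc j)))

sumF-mono-< : ∀ {k} {f g : Fin k → ℕ} → (∀ i → f i ≤ g i) → ∀ i → f i < g i → sumF f < sumF g
sumF-mono-< f≤g zero    f<g = +-mono-<-≤ f<g (sumF-mono-≤ (λ j → f≤g (suc j)))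
sumF-mono-< f≤g (suc i) f<g = +-mono-≤-< (f≤g zero) (sumF-mono-< (λ j → f≤g (suc j)) i f<g)

term≤sumF : ∀ {k} (f : Fin k → ℕ) i → f i ≤ sumF f
term≤sumF f zero    = m≤m+n _ _
term≤sumF f (suc i) = ≤-trans (term≤sumF (λ j → f (suc j)) i) (m≤n+m _ (f zero))

sumF-zero : ∀ {k} (f : Fin k → ℕ) → (∀ i → f i ≡ 0) → sumF f ≡ 0
sumF-zero {zero}  f _   = refl
sumF-zero {suc k} f f≗0 = cong₂ _+_ (f≗0 zero) (sumF-zero (λ j → f (suc j)) (λ j → f≗0 (suc j)))

_except_ : ∀ {k} → (Fin k → ℕ) → Fin k → Fin k → ℕ
(f except zero)  zero    = 0
(f except zero)  (suc j) = f (suc j)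
(f except suc i) zero    = f zero
(f except suc i) (suc j) = ((λ l → f (suc l)) except i) j

sumF-except : ∀ {k} (f : Fin k → ℕ) i → sumF f ≡ f i + sumF (f except i)
sumF-except f zero    = refl
sumF-except f (suc i) =
  trans (cong (f zero +_) (sumF-except (λ j → f (suc j)) i)) (x∙yz≈y∙xz (f zero) (f (suc i)) _)

except-≢ : ∀ {k} (f : Fin k → ℕ) {i j} → j ≢ i → (f except i) j ≡ f j
except-≢ f {zero}  {zero}  j≢i = ⊥-elim (j≢i refl)
except-≢ f {zero}  {suc j} _   = refl
except-≢ f {suc i} {zero}  _   = refl
except-≢ f {suc i} {suc j} j≢i = except-≢ (λ l → f (suc l)) (j≢i ∘ cong suc)

sum-distinct≤sumF : ∀ {k} (f : Fin k → ℕ) {is : List (Fin k)} → Unique is → sum (map f is) ≤ sumF f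
sum-distinct≤sumF f []                   = z≤n
sum-distinct≤sumF f {i ∷ is} (i≢is ∷ uniq) = begin
  f i + sum (map f is)              ≡⟨ cong (λ l → f i + sum l) (map-cong-local (All.map unchanged i≢is)) ⟩
  f i + sum (map (f except i) is)   ≤⟨ +-monoʳ-≤ (f i) (sum-distinct≤sumF (f except i) uniq) ⟩
  f i + sumF (f except i)           ≡⟨ sumF-except f i ⟨
  sumF f                            ∎
  where
  open ≤-Reasoning
  unchanged : ∀ {j} → i ≢ j → f j ≡ (f except i) j
  unchanged i≢j = sym (except-≢ f (i≢j ∘ sym))

countF : ∀ {k} → (Fin k → Bool) → ℕ
countF p = sumF (λ i → ind (p i))

countF-cong : ∀ {k} {p q : Fin k → Bool} → (∀ i → p i ≡ q i) → countF p ≡ countF q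
countF-cong p≗q = sumF-cong (cong ind ∘ p≗q)

countF≤ : ∀ {k} (p : Fin k → Bool) → countF p ≤ k
countF≤ {zero}  p = z≤n
countF≤ {suc k} p = +-mono-≤ (ind≤1 (p zero)) (countF≤ (λ j → p (suc j)))
  where
  ind≤1 : ∀ b → ind b ≤ 1
  ind≤1 true  = s≤s z≤n
  ind≤1 false = z≤n

countF< : ∀ {k} (p : Fin k → Bool) i → p i ≡ false → countF p < k
countF< p zero    p0 rewrite p0 = s≤s (countF≤ (λ j → p (suc j)))
countF< p (suc i) pi with p zero
... | true  = s≤s (countF< (λ j → p (suc j)) i pi)
... | false = m≤n⇒m≤1+n (countF< (λ j → p (suc j)) i pi)

countF≥1 : ∀ {k} (p : Fin k → Bool) i → p i ≡ true → 1 ≤ countF p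
countF≥1 p i pi = ≤-trans (≤-reflexive (cong ind (sym pi))) (term≤sumF (λ j → ind (p j)) i)

countF-mono-< : ∀ {k} (p q : Fin k → Bool) → (∀ i → p i ≡ true → q i ≡ true) →
  ∀ i → p i ≡ false → q i ≡ true → countF p < countF q
countF-mono-< p q p⇒q i pi qi = sumF-mono-< (λ j → ind-mono (p⇒q j)) i (ind-< pi qi)
  where
  ind-mono : ∀ {a b} → (a ≡ true → b ≡ true) → ind a ≤ ind b
  ind-mono {false} _   = z≤n
  ind-mono {true}  a⇒b rewrite a⇒b refl = s≤s z≤n
  ind-< : ∀ {a b} → a ≡ false → b ≡ true → ind a < ind b
  ind-< refl refl = s≤s z≤n

countF-witness : ∀ {k} (p : Fin k → Bool) → 1 ≤ countF p → ∃[ i ] p i ≡ true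
countF-witness {suc k} p pos with p zero in p0
... | true  = zero , p0
... | false with countF-witness (λ j → p (suc j)) pos
...   | i , pi = suc i , pi

countF≤1 : ∀ {k} (p : Fin k → Bool) → (∀ i j → p i ≡ true → p j ≡ true → i ≡ j) → countF p ≤ 1
countF≤1 {zero}  p _    = z≤n
countF≤1 {suc k} p uniq with p zero in p0
... | true  = s≤s (≤-reflexive (sumF-zero _ rest-false))
  where
  rest-false : ∀ j → ind (p (suc j)) ≡ 0
  rest-false j with p (suc j) in pj
  ... | false = refl
  ... | true with () ← uniq zero (suc j) p0 pj
... | false = countF≤1 (λ j → p (suc j)) (λ i j pi pj → suc-injective (uniq (suc i) (suc j) pi pj))

countF-== : ∀ {k} (v : Fin k) → countF (_== v) ≡ 1
countF-== v = ≤-antisym (countF≤1 (_== v) (λ i j i=v j=v → trans (==⇒≡ i=v) (sym (==⇒≡ j=v))))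
                        (countF≥1 (_== v) v (≡⇒== refl))

countF-split : ∀ {k} (a q : Fin k → Bool) →
  countF q ≡ countF (λ i → a i ∧ q i) + countF (λ i → not (a i) ∧ q i)
countF-split a q = trans (sumF-cong (λ i → ind-split (a i) (q i)))
                         (sumF-distrib-+ (λ i → ind (a i ∧ q i)) (λ i → ind (not (a i) ∧ q i)))

countF-∨-disjoint : ∀ {k} (p q : Fin k → Bool) → (∀ i → p i ≡ true → q i ≡ false) →
  countF (λ i → p i ∨ q i) ≡ countF p + countF q
countF-∨-disjoint p q disjoint = trans (sumF-cong (λ i → ind-∨-disjoint (p i) (q i) (disjoint i)))
                                       (sumF-distrib-+ (λ i → ind (p i)) (λ i → ind (q i)))

least-witness : ∀ {k} (p : Fin k → Bool) i → p i ≡ true →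
  ∃[ r ] p r ≡ true × (∀ j → p j ≡ true → toℕ r ≤ toℕ j)
least-witness {suc k} p i pi with p zero in p0
... | true = zero , p0 , λ _ _ → z≤n
least-witness p zero    pi | false with () ← trans (sym pi) p0
least-witness p (suc i) pi | false with least-witness (λ j → p (suc j)) i pi
... | r , pr , least = suc r , pr , least′
  where
  least′ : ∀ j → p j ≡ true → toℕ (suc r) ≤ toℕ j
  least′ zero    pj with () ← trans (sym pj) p0
  least′ (suc j) pj = s≤s (least j pj)

sum-of-two-flags≤suc : ∀ {a b s} → a ≤ 1 → b ≤ 1 → (1 ≤ a → 1 ≤ b → 1 ≤ s) → a + b ≤ suc s
sum-of-two-flags≤suc z≤n       b≤1       _    = ≤-trans b≤1 (s≤s z≤n)
sum-of-two-flags≤suc (s≤s z≤n) z≤n       _    = s≤s z≤n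
sum-of-two-flags≤suc (s≤s z≤n) (s≤s z≤n) both = s≤s (both (s≤s z≤n) (s≤s z≤n))

lookup-minus-self : ∀ {k} (p : Subset k) x → lookup (p - x) x ≡ false
lookup-minus-self (s ∷ p) zero    = refl
lookup-minus-self (s ∷ p) (suc x) = lookup-minus-self p x

lookup-minus-≢ : ∀ {k} (p : Subset k) {x v} → v ≢ x → lookup (p - x) v ≡ lookup p v
lookup-minus-≢ (s ∷ p) {zero}  {zero}  v≢x = ⊥-elim (v≢x refl)
lookup-minus-≢ (s ∷ p) {zero}  {suc v} _   = cong (λ q → lookup q v) (p─⊥≡p p)
lookup-minus-≢ (s ∷ p) {suc x} {zero}  _   = refl
lookup-minus-≢ (s ∷ p) {suc x} {suc v} v≢x = lookup-minus-≢ p (v≢x ∘ cong suc)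

module _ (G : Graph) where

  Vertex Edge : Set
  Vertex = Fin (n G)
  Edge   = Fin (m G)

  Outside : Subset (n G) → Vertex → Set
  Outside X v = inX G X v ≡ false

  Joins : Edge → Vertex → Vertex → Set
  Joins e u v = (src G e ≡ u × tgt G e ≡ v) ⊎ (src G e ≡ v × tgt G e ≡ u)

  Joins-sym : ∀ {e u v} → Joins e u v → Joins e v u
  Joins-sym (inj₁ ends) = inj₂ ends
  Joins-sym (inj₂ ends) = inj₁ ends

  Joins-other-end : ∀ {e x c c′} → Joins e x c → Joins e x c′ → c ≢ x → c ≡ c′
  Joins-other-end (inj₁ (_ , t)) (inj₁ (_ , t′)) _   = trans (sym t) t′
  Joins-other-end (inj₁ (_ , t)) (inj₂ (_ , t′)) c≢x = ⊥-elim (c≢x (trans (sym t) t′))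
  Joins-other-end (inj₂ (s , _)) (inj₁ (s′ , _)) c≢x = ⊥-elim (c≢x (trans (sym s) s′))
  Joins-other-end (inj₂ (s , _)) (inj₂ (s′ , _)) _   = trans (sym s) s′

  adj⁺ : ∀ X {u v} e → Outside X u → Outside X v → Joins e u v → adj G X u v ≡ true
  adj⁺ X {u} {v} e u∉X v∉X joins =
    ∧≡true⁺ (≡false⇒not≡true u∉X) (∧≡true⁺ (≡false⇒not≡true v∉X) (anyF⁺ _ e (edge-test joins)))
    where
    edge-test : Joins e u v → ((src G e == u ∧ tgt G e == v) ∨ (src G e == v ∧ tgt G e == u)) ≡ true
    edge-test (inj₁ (s , t)) = ∨≡true⁺ˡ _ (∧≡true⁺ (≡⇒== s) (≡⇒== t))
    edge-test (inj₂ (s , t)) = ∨≡true⁺ʳ _ (∧≡true⁺ (≡⇒== s) (≡⇒== t))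

  adj⁻ : ∀ X {u v} → adj G X u v ≡ true → Outside X u × Outside X v × ∃[ e ] Joins e u v
  adj⁻ X {u} {v} uv with ∧≡true⁻ (not (inX G X u)) uv
  ... | u∉X , rest with ∧≡true⁻ (not (inX G X v)) rest
  ...   | v∉X , edge with anyF⁻ _ edge
  ...     | e , test = not≡true⇒≡false u∉X , not≡true⇒≡false v∉X , e , joins (∨≡true⁻ _ test)
    where
    joins : (src G e == u ∧ tgt G e == v) ≡ true ⊎ (src G e == v ∧ tgt G e == u) ≡ true → Joins e u v
    joins (inj₁ st) = let s , t = ∧≡true⁻ (src G e == u) st in inj₁ (==⇒≡ s , ==⇒≡ t)
    joins (inj₂ st) = let s , t = ∧≡true⁻ (src G e == v) st in inj₂ (==⇒≡ s , ==⇒≡ t)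

  adj-sym : ∀ X {u v} → adj G X u v ≡ true → adj G X v u ≡ true
  adj-sym X uv with adj⁻ X uv
  ... | u∉X , v∉X , e , joins = adj⁺ X e v∉X u∉X (Joins-sym joins)

  reach-zero⁺ : ∀ X {u} → Outside X u → reach G X 0 u u ≡ true
  reach-zero⁺ X {u} u∉X = ∧≡true⁺ (≡⇒== {u = u} refl) (≡false⇒not≡true u∉X)

  reach-zero⁻ : ∀ X {u v} → reach G X 0 u v ≡ true → u ≡ v × Outside X u
  reach-zero⁻ X {u} {v} r = let u=v , u∉X = ∧≡true⁻ (u == v) r in ==⇒≡ u=v , not≡true⇒≡false u∉X

  reach-suc⁺ : ∀ X k {u} w {v} → reach G X k u w ≡ true → adj G X w v ≡ true →
    reach G X (suc k) u v ≡ true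
  reach-suc⁺ X k {u} w {v} r a =
    ∨≡true⁺ʳ (reach G X k u v) (anyF⁺ (λ w → reach G X k u w ∧ adj G X w v) w (∧≡true⁺ r a))

  reach-suc⁻ : ∀ X k {u v} → reach G X (suc k) u v ≡ true →
    reach G X k u v ≡ true ⊎ ∃[ w ] reach G X k u w ≡ true × adj G X w v ≡ true
  reach-suc⁻ X k {u} {v} r with ∨≡true⁻ (reach G X k u v) r
  ... | inj₁ shorter = inj₁ shorter
  ... | inj₂ step with anyF⁻ (λ w → reach G X k u w ∧ adj G X w v) step
  ...   | w , rw = inj₂ (w , ∧≡true⁻ (reach G X k u w) rw)

  reach-suc : ∀ X k {u v} → reach G X k u v ≡ true → reach G X (suc k) u v ≡ true
  reach-suc X k = ∨≡true⁺ˡ _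

  reach-+ : ∀ X j k {u v} → reach G X k u v ≡ true → reach G X (j + k) u v ≡ true
  reach-+ X zero    k r = r
  reach-+ X (suc j) k r = reach-suc X (j + k) (reach-+ X j k r)

  reach⇒Outside : ∀ X k {u v} → reach G X k u v ≡ true → Outside X u × Outside X v
  reach⇒Outside X zero r with reach-zero⁻ X r
  ... | refl , u∉X = u∉X , u∉X
  reach⇒Outside X (suc k) r with reach-suc⁻ X k r
  ... | inj₁ shorter          = reach⇒Outside X k shorter
  ... | inj₂ (w , rw , wv)    = proj₁ (reach⇒Outside X k rw) , proj₁ (proj₂ (adj⁻ X wv))

  data Reachable (X : Subset (n G)) (u v : Vertex) : Set where
    walk : ∀ k → reach G X k u v ≡ true → Reachable X u v

  Reachable⇒Outside : ∀ {X u v} → Reachable X u v → Outside X u × Outside X v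
  Reachable⇒Outside {X} (walk k r) = reach⇒Outside X k r

  Reachable-refl : ∀ {X u} → Outside X u → Reachable X u u
  Reachable-refl {X} u∉X = walk 0 (reach-zero⁺ X u∉X)

  adj⇒Reachable : ∀ {X u v} → adj G X u v ≡ true → Reachable X u v
  adj⇒Reachable {X} uv = walk 1 (reach-suc⁺ X 0 _ (reach-zero⁺ X (proj₁ (adj⁻ X uv))) uv)

  Reachable-trans : ∀ {X u w v} → Reachable X u w → Reachable X w v → Reachable X u v
  Reachable-trans {X} {u} {w} (walk k uw) (walk j wv) = walk (j + k) (extend j wv)
    where
    extend : ∀ j {v} → reach G X j w v ≡ true → reach G X (j + k) u v ≡ true
    extend zero    wv with reach-zero⁻ X wv
    ... | refl , _ = uw
    extend (suc j) wv with reach-suc⁻ X j wv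
    ... | inj₁ shorter      = reach-suc X (j + k) (extend j shorter)
    ... | inj₂ (w′ , r , a) = reach-suc⁺ X (j + k) w′ (extend j r) a

  Reachable-sym : ∀ {X u v} → Reachable X u v → Reachable X v u
  Reachable-sym {X} (walk k r) = back k r
    where
    back : ∀ k {u v} → reach G X k u v ≡ true → Reachable X v u
    back zero    r with reach-zero⁻ X r
    ... | refl , _ = walk 0 r
    back (suc k) r with reach-suc⁻ X k r
    ... | inj₁ shorter     = back k shorter
    ... | inj₂ (w , r , a) = Reachable-trans (adj⇒Reachable (adj-sym X a)) (back k r)

  Reachable-antimono : ∀ {X Y u v} → (∀ w → Outside X w → Outside Y w) →
    Reachable X u v → Reachable Y u v
  Reachable-antimono {X} {Y} X⊇Y (walk k r) = walk k (shrink k r)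
    where
    shrink : ∀ k {u v} → reach G X k u v ≡ true → reach G Y k u v ≡ true
    shrink zero    r with reach-zero⁻ X r
    ... | refl , u∉X = reach-zero⁺ Y (X⊇Y _ u∉X)
    shrink (suc k) r with reach-suc⁻ X k r
    ... | inj₁ shorter     = reach-suc Y k (shrink k shorter)
    ... | inj₂ (w , r , a) with adj⁻ X a
    ...   | w∉X , v∉X , e , joins =
      reach-suc⁺ Y k w (shrink k r) (adj⁺ Y e (X⊇Y _ w∉X) (X⊇Y _ v∉X) joins)

  Saturated : Subset (n G) → Vertex → ℕ → Set
  Saturated X u k = ∀ j {v} → reach G X (j + k) u v ≡ true → reach G X k u v ≡ true

  saturated-if-stationary : ∀ X u k → (∀ v → reach G X (suc k) u v ≡ true → reach G X k u v ≡ true) →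
    Saturated X u k
  saturated-if-stationary X u k stationary zero    r = r
  saturated-if-stationary X u k stationary (suc j) r with reach-suc⁻ X (j + k) r
  ... | inj₁ shorter     = saturated-if-stationary X u k stationary j shorter
  ... | inj₂ (w , r , a) =
    stationary _ (reach-suc⁺ X k w (saturated-if-stationary X u k stationary j r) a)

  saturated-suc : ∀ X u k → Saturated X u k → Saturated X u (suc k)
  saturated-suc X u k sat j {v} r rewrite +-suc j k = reach-suc X k (sat (suc j) r)

  saturated-or-large : ∀ X u k → Saturated X u k ⊎ k ≤ countF (reach G X k u)
  saturated-or-large X u zero = inj₂ z≤n
  saturated-or-large X u (suc k) with saturated-or-large X u k
  ... | inj₁ sat = inj₁ (saturated-suc X u k sat)
  ... | inj₂ k≤size with allF (λ v → not (reach G X (suc k) u v) ∨ reach G X k u v) in stationary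
  ...   | true = inj₁ (saturated-suc X u k (saturated-if-stationary X u k
                   (λ v → not-∨≡true⁻ (reach G X (suc k) u v) (allF⁻ _ stationary v))))
  ...   | false with allF-false⇒∃false _ stationary
  ...     | w , new with not-∨≡false⁻ (reach G X (suc k) u w) (reach G X k u w) new
  ...       | reached , unreached = inj₂ (≤-trans (s≤s k≤size)
    (countF-mono-< (reach G X k u) (reach G X (suc k) u) (λ v → reach-suc X k) w unreached reached))

  -- A ball that is still growing at radius n has more than n vertices.
  reach-saturated : ∀ X u j {v} → reach G X (j + n G) u v ≡ true → reach G X (n G) u v ≡ true
  reach-saturated X u j {v} r with saturated-or-large X u (n G)
  ... | inj₁ sat = sat j r
  ... | inj₂ n≤size with reach G X (n G) u v in unreached
  ...   | true  = refl
  ...   | false = ⊥-elim (<-irrefl refl (≤-trans (s≤s n≤size) (countF< (reach G X (n G) u) v unreached)))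

  Reachable⇒sameComp : ∀ {X u v} → Reachable X u v → sameComp G X u v ≡ true
  Reachable⇒sameComp {X} {u} {v} (walk k r) =
    reach-saturated X u k (subst (λ l → reach G X l u v ≡ true) (+-comm (n G) k) (reach-+ X (n G) k r))

  sameComp⇒Reachable : ∀ {X u v} → sameComp G X u v ≡ true → Reachable X u v
  sameComp⇒Reachable = walk (n G)

  sameComp-ext : ∀ {X Y u v} →
    (∀ w → Reachable X u w → Reachable Y v w) → (∀ w → Reachable Y v w → Reachable X u w) →
    ∀ w → sameComp G X u w ≡ sameComp G Y v w
  sameComp-ext to from w = ≡true-ext (Reachable⇒sameComp ∘ to w ∘ sameComp⇒Reachable)
                                     (Reachable⇒sameComp ∘ from w ∘ sameComp⇒Reachable)

  isOdd-+ : ∀ p q → isOdd G (p + q) ≡ isOdd G p xor isOdd G q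
  isOdd-+ zero    q = refl
  isOdd-+ (suc p) q = trans (cong not (isOdd-+ p q)) (not-distribˡ-xor (isOdd G p) (isOdd G q))

  isOdd-suc-+ : ∀ p q → isOdd G p ≡ true → isOdd G q ≡ true → isOdd G (suc (p + q)) ≡ true
  isOdd-suc-+ p q p-odd q-odd = cong not (trans (isOdd-+ p q) (cong₂ _xor_ p-odd q-odd))

  oddRep : Subset (n G) → Vertex → Bool
  oddRep X v = isRep G X v ∧ isOdd G (compSize G X v)

  oddRep-cong : ∀ {X Y v} → inX G X v ≡ inX G Y v → (∀ w → sameComp G X v w ≡ sameComp G Y v w) →
    oddRep X v ≡ oddRep Y v
  oddRep-cong v∈X⇔v∈Y same =
    cong₂ _∧_ (cong₂ _∧_ (cong not v∈X⇔v∈Y) (allF-cong (λ w → cong (λ b → not b ∨ _) (same w))))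
              (cong (isOdd G) (countF-cong same))

  compSize-cong : ∀ {X u v} → Reachable X u v → compSize G X u ≡ compSize G X v
  compSize-cong uv = countF-cong (sameComp-ext (λ w → Reachable-trans (Reachable-sym uv))
                                              (λ w → Reachable-trans uv))

  isRep⇒Outside : ∀ {X r} → isRep G X r ≡ true → Outside X r
  isRep⇒Outside {X} {r} rep = not≡true⇒≡false (∧-conicalˡ (not (inX G X r)) _ rep)

  isRep-least : ∀ {X r w} → isRep G X r ≡ true → Reachable X r w → toℕ r ≤ toℕ w
  isRep-least {X} {r} {w} rep rw =
    ≤ᵇ⇒≤ (toℕ r) (toℕ w) (Equivalence.from T-≡ (not-∨≡true⁻ (sameComp G X r w)
      (allF⁻ _ (∧-conicalʳ (not (inX G X r)) _ rep) w) (Reachable⇒sameComp rw)))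

  isRep-unique : ∀ {X r r′} → isRep G X r ≡ true → isRep G X r′ ≡ true → Reachable X r r′ → r ≡ r′
  isRep-unique rep rep′ rr′ =
    toℕ-injective (≤-antisym (isRep-least rep rr′) (isRep-least rep′ (Reachable-sym rr′)))

  component-rep : ∀ {X u} → Outside X u → ∃[ r ] isRep G X r ≡ true × Reachable X u r
  component-rep {X} {u} u∉X
    with least-witness (sameComp G X u) u (Reachable⇒sameComp (Reachable-refl u∉X))
  ... | r , ur , least = r , rep , sameComp⇒Reachable ur
    where
    rep : isRep G X r ≡ true
    rep = ∧≡true⁺ (≡false⇒not≡true (proj₂ (Reachable⇒Outside (sameComp⇒Reachable ur))))
            (allF⁺ _ λ w → not-∨≡true⁺ (sameComp G X r w) λ rw →
              Equivalence.to T-≡ (≤⇒≤ᵇ (least w (Reachable⇒sameComp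
                (Reachable-trans (sameComp⇒Reachable ur) (sameComp⇒Reachable rw))))))

  reps-in-one-component≤1 : ∀ X (p : Vertex → Bool) c →
    (∀ v → p v ≡ true → isRep G X v ≡ true × Reachable X c v) → countF p ≤ 1
  reps-in-one-component≤1 X p c in-c = countF≤1 p λ i j pi pj →
    isRep-unique (proj₁ (in-c i pi)) (proj₁ (in-c j pj))
                 (Reachable-trans (Reachable-sym (proj₂ (in-c i pi))) (proj₂ (in-c j pj)))

  NeighboursAmong : Subset (n G) → Vertex → Vertex → Vertex → Set
  NeighboursAmong Y x a b = ∀ c → c ≢ x → adj G Y x c ≡ true → c ≡ a ⊎ c ≡ b

  module _ {X : Subset (n G)} {x : Vertex} (x∈X : x ∈ X) where

    private
      x-inside : inX G X x ≡ true
      x-inside = []=⇒lookup x∈X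

    Outside⇒≢ : ∀ {v} → Outside X v → v ≢ x
    Outside⇒≢ v∉X refl = ≡true⇒≢false x-inside v∉X

    sameComp⇒≢x : ∀ {c v} → sameComp G X c v ≡ true → v ≢ x
    sameComp⇒≢x = Outside⇒≢ ∘ proj₂ ∘ Reachable⇒Outside ∘ sameComp⇒Reachable

    Outside-minus-self : Outside (X - x) x
    Outside-minus-self = lookup-minus-self X x

    Outside-minus : ∀ {v} → Outside X v → Outside (X - x) v
    Outside-minus v∉X = trans (lookup-minus-≢ X (Outside⇒≢ v∉X)) v∉X

    Outside-minus⁻ : ∀ {v} → v ≢ x → Outside (X - x) v → Outside X v
    Outside-minus⁻ v≢x v∉Y = trans (sym (lookup-minus-≢ X v≢x)) v∉Y

    Reachable-minus : ∀ {u v} → Reachable X u v → Reachable (X - x) u v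
    Reachable-minus = Reachable-antimono (λ _ → Outside-minus)

    Reachable-step-minus : ∀ {u w v} → Reachable X u w → v ≢ x → adj G (X - x) w v ≡ true → Reachable X u v
    Reachable-step-minus uw v≢x wv with adj⁻ (X - x) wv
    ... | _ , v∉Y , e , joins = Reachable-trans uw
      (adj⇒Reachable (adj⁺ X e (proj₂ (Reachable⇒Outside uw)) (Outside-minus⁻ v≢x v∉Y) joins))

    reach-minus : ∀ k {u v} → reach G (X - x) k u v ≡ true → Reachable X u v ⊎ Reachable (X - x) u x
    reach-minus zero {u} r with reach-zero⁻ (X - x) r | u ≟ x
    ... | refl , _   | yes refl = inj₂ (Reachable-refl Outside-minus-self)
    ... | refl , u∉Y | no u≢x   = inj₁ (Reachable-refl (Outside-minus⁻ u≢x u∉Y))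
    reach-minus (suc k) {v = v} r with reach-suc⁻ (X - x) k r
    ... | inj₁ shorter = reach-minus k shorter
    ... | inj₂ (w , uw , wv) with reach-minus k uw | v ≟ x
    ...   | inj₂ ux | _        = inj₂ ux
    ...   | inj₁ _  | yes refl = inj₂ (walk (suc k) r)
    ...   | inj₁ uw′ | no v≢x  = inj₁ (Reachable-step-minus uw′ v≢x wv)

    reach-from-removed : ∀ k {v} → reach G (X - x) k x v ≡ true →
      v ≡ x ⊎ ∃[ c ] c ≢ x × adj G (X - x) x c ≡ true × Reachable X c v
    reach-from-removed zero r = inj₁ (sym (proj₁ (reach-zero⁻ (X - x) r)))
    reach-from-removed (suc k) {v} r with reach-suc⁻ (X - x) k r
    ... | inj₁ shorter = reach-from-removed k shorter
    ... | inj₂ (w , xw , wv) with v ≟ x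
    ...   | yes v≡x = inj₁ v≡x
    ...   | no v≢x with reach-from-removed k xw
    ...     | inj₁ refl =
      inj₂ (v , v≢x , wv , Reachable-refl (Outside-minus⁻ v≢x (proj₁ (proj₂ (adj⁻ (X - x) wv)))))
    ...     | inj₂ (c , c≢x , xc , cw) = inj₂ (c , c≢x , xc , Reachable-step-minus cw v≢x wv)

    Reachable-minus-covered : ∀ {a b} → NeighboursAmong (X - x) x a b →
      ∀ {v} → Reachable (X - x) x v → v ≡ x ⊎ Reachable X a v ⊎ Reachable X b v
    Reachable-minus-covered among (walk k r) with reach-from-removed k r
    ... | inj₁ v≡x = inj₁ v≡x
    ... | inj₂ (c , c≢x , xc , cv) with among c c≢x xc
    ...   | inj₁ refl = inj₂ (inj₁ cv)
    ...   | inj₂ refl = inj₂ (inj₂ cv)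

    Cₓ : Vertex → Bool
    Cₓ = sameComp G (X - x) x

    x∈Cₓ : Cₓ x ≡ true
    x∈Cₓ = Reachable⇒sameComp (Reachable-refl Outside-minus-self)

    oddRep-outside-Cₓ : ∀ v → not (Cₓ v) ∧ oddRep X v ≡ not (Cₓ v) ∧ oddRep (X - x) v
    oddRep-outside-Cₓ v with Cₓ v in Cₓv
    ... | true  = refl
    ... | false = oddRep-cong (sym (lookup-minus-≢ X v≢x))
                    (sameComp-ext (λ w → Reachable-minus) from)
      where
      v≢x : v ≢ x
      v≢x refl = ≡true⇒≢false x∈Cₓ Cₓv
      from : ∀ w → Reachable (X - x) v w → Reachable X v w
      from w (walk k r) with reach-minus k r
      ... | inj₁ vw = vw
      ... | inj₂ vx = ⊥-elim (≡true⇒≢false (Reachable⇒sameComp (Reachable-sym vx)) Cₓv)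

    oddRepsInCₓ oddRepsOffCₓ : Subset (n G) → ℕ
    oddRepsInCₓ  Z = countF (λ v → Cₓ v ∧ oddRep Z v)
    oddRepsOffCₓ Z = countF (λ v → not (Cₓ v) ∧ oddRep Z v)

    Cₓ-has-oddRep : isOdd G (compSize G (X - x) x) ≡ true → 1 ≤ oddRepsInCₓ (X - x)
    Cₓ-has-oddRep odd with component-rep Outside-minus-self
    ... | r , rep , xr = countF≥1 _ r (∧≡true⁺ (Reachable⇒sameComp xr)
                           (∧≡true⁺ rep (trans (cong (isOdd G) (sym (compSize-cong xr))) odd)))

    Cₓ-size : ∀ {a b} → NeighboursAmong (X - x) x a b → ∀ {u w} → Reachable X a u → Reachable X b w →
      ¬ Reachable X u w → Reachable (X - x) x u → Reachable (X - x) x w →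
      compSize G (X - x) x ≡ suc (compSize G X u + compSize G X w)
    Cₓ-size among {u} {w} au bw u≁w xu xw =
      trans (countF-cong Cₓ≗)
        (trans (countF-∨-disjoint (_== x) (λ v → U v ∨ W v) x∉U∪W)
               (cong₂ _+_ (countF-== x) (countF-∨-disjoint U W U∩W)))
      where
      U W : Vertex → Bool
      U = sameComp G X u
      W = sameComp G X w
      x∉U∪W : ∀ v → v == x ≡ true → U v ∨ W v ≡ false
      x∉U∪W v v=x = ¬-not λ uw → [ sameComp⇒≢x , sameComp⇒≢x ]′ (∨≡true⁻ (U v) uw) (==⇒≡ v=x)
      U∩W : ∀ v → U v ≡ true → W v ≡ false
      U∩W v uv = ¬-not λ wv →
        u≁w (Reachable-trans (sameComp⇒Reachable uv) (Reachable-sym (sameComp⇒Reachable wv)))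
      to : ∀ {v} → Cₓ v ≡ true → (v == x) ∨ (U v ∨ W v) ≡ true
      to {v} xv with Reachable-minus-covered among (sameComp⇒Reachable xv)
      ... | inj₁ v≡x       = ∨≡true⁺ˡ _ (≡⇒== v≡x)
      ... | inj₂ (inj₁ av) =
        ∨≡true⁺ʳ (v == x) (∨≡true⁺ˡ _ (Reachable⇒sameComp (Reachable-trans (Reachable-sym au) av)))
      ... | inj₂ (inj₂ bv) =
        ∨≡true⁺ʳ (v == x) (∨≡true⁺ʳ (U v) (Reachable⇒sameComp (Reachable-trans (Reachable-sym bw) bv)))
      from : ∀ {v} → (v == x) ∨ (U v ∨ W v) ≡ true → Cₓ v ≡ true
      from {v} p with ∨≡true⁻ (v == x) p
      ... | inj₁ v=x = subst (λ y → Cₓ y ≡ true) (sym (==⇒≡ v=x)) x∈Cₓ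
      ... | inj₂ uw with ∨≡true⁻ (U v) uw
      ...   | inj₁ uv = Reachable⇒sameComp (Reachable-trans xu (Reachable-minus (sameComp⇒Reachable uv)))
      ...   | inj₂ wv = Reachable⇒sameComp (Reachable-trans xw (Reachable-minus (sameComp⇒Reachable wv)))
      Cₓ≗ : ∀ v → Cₓ v ≡ (v == x) ∨ (U v ∨ W v)
      Cₓ≗ v = ≡true-ext to from

    -- Split the odd components of G - X inside Cₓ by whether they contain a: at most one does, at most
    -- one (that of b) does not, and if both kinds occur they merge with x into an odd component of
    -- G - (X - x).
    oddRepsInCₓ-minus : ∀ {a b} → NeighboursAmong (X - x) x a b → oddRepsInCₓ X ≤ suc (oddRepsInCₓ (X - x))
    oddRepsInCₓ-minus {a} {b} among = begin
      countF P                                                  ≡⟨ countF-split A P ⟩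
      countF (λ v → A v ∧ P v) + countF (λ v → not (A v) ∧ P v) ≤⟨ sum-of-two-flags≤suc in-A≤1 off-A≤1 both ⟩
      suc (oddRepsInCₓ (X - x))                                 ∎
      where
      open ≤-Reasoning
      P A : Vertex → Bool
      P v = Cₓ v ∧ oddRep X v
      A   = sameComp G X a
      unpack : ∀ {v} → P v ≡ true →
        Reachable (X - x) x v × isRep G X v ≡ true × isOdd G (compSize G X v) ≡ true
      unpack {v} pv with ∧≡true⁻ (Cₓ v) pv
      ... | xv , rep-odd = sameComp⇒Reachable xv , ∧≡true⁻ (isRep G X v) rep-odd
      off-A⇒from-b : ∀ {v} → not (A v) ∧ P v ≡ true → Reachable X b v
      off-A⇒from-b {v} p with ∧≡true⁻ (not (A v)) p
      ... | v∉A , pv with unpack pv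
      ...   | xv , rep , _ with Reachable-minus-covered among xv
      ...     | inj₁ v≡x       = ⊥-elim (Outside⇒≢ (isRep⇒Outside rep) v≡x)
      ...     | inj₂ (inj₁ av) = ⊥-elim (≡true⇒≢false (Reachable⇒sameComp av) (not≡true⇒≡false v∉A))
      ...     | inj₂ (inj₂ bv) = bv
      in-A≤1 : countF (λ v → A v ∧ P v) ≤ 1
      in-A≤1 = reps-in-one-component≤1 X (λ v → A v ∧ P v) a λ v p →
        let av , pv = ∧≡true⁻ (A v) p in proj₁ (proj₂ (unpack pv)) , sameComp⇒Reachable av
      off-A≤1 : countF (λ v → not (A v) ∧ P v) ≤ 1
      off-A≤1 = reps-in-one-component≤1 X (λ v → not (A v) ∧ P v) b λ v p →
        proj₁ (proj₂ (unpack (proj₂ (∧≡true⁻ (not (A v)) p)))) , off-A⇒from-b p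
      both : 1 ≤ countF (λ v → A v ∧ P v) → 1 ≤ countF (λ v → not (A v) ∧ P v) → 1 ≤ oddRepsInCₓ (X - x)
      both inA offA with countF-witness _ inA | countF-witness _ offA
      ... | u , u∈A | w , w∉A with ∧≡true⁻ (A u) u∈A | ∧≡true⁻ (not (A w)) w∉A
      ...   | au , pu | w∉A′ , pw with unpack pu | unpack pw
      ...     | xu , _ , u-odd | xw , _ , w-odd =
        Cₓ-has-oddRep (subst (λ s → isOdd G s ≡ true) (sym size)
                               (isOdd-suc-+ (compSize G X u) (compSize G X w) u-odd w-odd))
        where
        u≁w : ¬ Reachable X u w
        u≁w uw = ≡true⇒≢false (Reachable⇒sameComp (Reachable-trans (sameComp⇒Reachable au) uw))
                              (not≡true⇒≡false w∉A′)
        size : compSize G (X - x) x ≡ suc (compSize G X u + compSize G X w)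
        size = Cₓ-size among (sameComp⇒Reachable au) (off-A⇒from-b w∉A) u≁w xu xw

    cOdd-minus : ∀ {a b} → NeighboursAmong (X - x) x a b → cOdd G X ≤ suc (cOdd G (X - x))
    cOdd-minus among = begin
      cOdd G X                                           ≡⟨ countF-split Cₓ (oddRep X) ⟩
      oddRepsInCₓ X + oddRepsOffCₓ X                     ≤⟨ +-monoˡ-≤ _ (oddRepsInCₓ-minus among) ⟩
      suc (oddRepsInCₓ (X - x)) + oddRepsOffCₓ X         ≡⟨ cong (_+_ (suc (oddRepsInCₓ (X - x)))) off-Cₓ ⟩
      suc (oddRepsInCₓ (X - x) + oddRepsOffCₓ (X - x))   ≡⟨ cong suc (countF-split Cₓ (oddRep (X - x))) ⟨
      suc (cOdd G (X - x))                               ∎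
      where
      open ≤-Reasoning
      off-Cₓ : oddRepsOffCₓ X ≡ oddRepsOffCₓ (X - x)
      off-Cₓ = countF-cong oddRep-outside-Cₓ

    Good-minus : ∀ {a b} → NeighboursAmong (X - x) x a b → Good G X → Good G (X - x)
    Good-minus among good = ≤-pred (≤-trans (s≤s (x∈p⇒∣p-x∣<∣p∣ x∈X)) (≤-trans good (cOdd-minus among)))

  incidences : Vertex → Edge → ℕ
  incidences x e = ind (src G e == x) + ind (tgt G e == x)

  Joins⇒incidences≥1 : ∀ {e x c} → Joins e x c → 1 ≤ incidences x e
  Joins⇒incidences≥1 (inj₁ (s , _)) rewrite ≡⇒== s = s≤s z≤n
  Joins⇒incidences≥1 {e} {x} (inj₂ (_ , t)) rewrite ≡⇒== t = m≤n+m 1 (ind (src G e == x))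

  loop-incidences : ∀ {e x} → Joins e x x → incidences x e ≡ 2
  loop-incidences (inj₁ (s , t)) rewrite ≡⇒== s | ≡⇒== t = refl
  loop-incidences (inj₂ (s , t)) rewrite ≡⇒== s | ≡⇒== t = refl

  extra-edges-coincide : ∀ {x} → degree G x ≡ 3 → ∀ {es} → Unique es → 2 ≤ sum (map (incidences x) es) →
    ∀ {e₁ e₂ c₁ c₂} → Joins e₁ x c₁ → Joins e₂ x c₂ → c₁ ≢ x → All (e₁ ≢_) es → All (e₂ ≢_) es → c₁ ≡ c₂
  extra-edges-coincide {x} cubic {es} distinct two {e₁} {e₂} j₁ j₂ c₁≢x e₁∉es e₂∉es with e₁ ≟ e₂
  ... | yes refl  = Joins-other-end j₁ j₂ c₁≢x
  ... | no e₁≢e₂ = ⊥-elim (<-irrefl (sym cubic) (begin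
    4
      ≤⟨ +-mono-≤ (Joins⇒incidences≥1 j₁) (+-mono-≤ (Joins⇒incidences≥1 j₂) two) ⟩
    incidences x e₁ + (incidences x e₂ + sum (map (incidences x) es))
      ≤⟨ sum-distinct≤sumF (incidences x) ((e₁≢e₂ ∷ e₁∉es) ∷ e₂∉es ∷ distinct) ⟩
    degree G x
      ∎))
    where open ≤-Reasoning

  -- Here y is the other end of the edges es, or x itself when es is a loop.
  double-edge⇒NeighboursAmong : ∀ {x y} → degree G x ≡ 3 → ∀ es → Unique es → All (λ e → Joins e x y) es →
    2 ≤ sum (map (incidences x) es) → ∀ Y → ∃[ b ] NeighboursAmong Y x y b
  double-edge⇒NeighboursAmong {x} {y} cubic es distinct x-y two Y = pick (any? other?)
    where
    Other : Vertex → Set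
    Other c = c ≢ x × c ≢ y × adj G Y x c ≡ true
    other? : Decidable Other
    other? c = ¬? (c ≟ x) ×-dec ¬? (c ≟ y) ×-dec (adj G Y x c Bool.≟ true)
    avoids : ∀ {e c} → Joins e x c → c ≢ x → c ≢ y → All (e ≢_) es
    avoids j c≢x c≢y = All.map (λ { j′ refl → c≢y (Joins-other-end j j′ c≢x) }) x-y
    unique : ∀ {c c′} → Other c → Other c′ → c ≡ c′
    unique (c≢x , c≢y , xc) (c′≢x , c′≢y , xc′) with adj⁻ Y xc | adj⁻ Y xc′
    ... | _ , _ , _ , j | _ , _ , _ , j′ =
      extra-edges-coincide cubic distinct two j j′ c≢x (avoids j c≢x c≢y) (avoids j′ c′≢x c′≢y)
    either : ∀ {b} c → (c ≢ y → c ≡ y ⊎ c ≡ b) → c ≡ y ⊎ c ≡ b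
    either c k with c ≟ y
    ... | yes c≡y = inj₁ c≡y
    ... | no  c≢y = k c≢y
    pick : Dec (∃[ c ] Other c) → ∃[ b ] NeighboursAmong Y x y b
    pick (yes (b , other-b)) = b , λ c c≢x xc → either c λ c≢y → inj₂ (unique (c≢x , c≢y , xc) other-b)
    pick (no  no-other)      = x , λ c c≢x xc → either c λ c≢y → ⊥-elim (no-other (c , c≢x , c≢y , xc))

  Parallel⇒Joins : ∀ {e e′} → Parallel G e e′ → Joins e′ (src G e) (tgt G e)
  Parallel⇒Joins (_ , _ , inj₁ (s , t)) = inj₁ (sym s , sym t)
  Parallel⇒Joins (_ , _ , inj₂ (s , t)) = inj₂ (sym t , sym s)

  module _ (cubic : Cubic G) {X : Subset (n G)} (minimal-good : MinimalGood G X) where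

    double-edge-end-outside : ∀ {x y} es → Unique es → All (λ e → Joins e x y) es →
      2 ≤ sum (map (incidences x) es) → x ∉ X
    double-edge-end-outside {x} es distinct x-y two x∈X
      with double-edge⇒NeighboursAmong (cubic x) es distinct x-y two (X - x)
    ... | _ , among =
      proj₂ minimal-good (X - x) (x∈p⇒p-x⊂p x∈X) (Good-minus x∈X among (proj₁ minimal-good))

    loop-end-outside : ∀ e → IsLoop G e → src G e ∉ X
    loop-end-outside e loop =
      double-edge-end-outside (e ∷ []) ([] ∷ []) (x-x ∷ [])
        (≤-reflexive (cong (_+ 0) (sym (loop-incidences x-x))))
      where
      x-x : Joins e (src G e) (src G e)
      x-x = inj₁ (refl , sym loop)

    parallel-end-outside : ∀ {e e′ x y} → e ≢ e′ → Joins e x y → Joins e′ x y → x ∉ X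
    parallel-end-outside {e} {e′} e≢e′ j j′ =
      double-edge-end-outside (e ∷ e′ ∷ []) ((e≢e′ ∷ []) ∷ [] ∷ []) (j ∷ j′ ∷ [])
        (+-mono-≤ (Joins⇒incidences≥1 j) (+-mono-≤ (Joins⇒incidences≥1 j′) z≤n))

    parallel-ends-outside : ∀ e e′ → Parallel G e e′ → src G e ∉ X × tgt G e ∉ X
    parallel-ends-outside e e′ parallel@(e≢e′ , _) =
      parallel-end-outside e≢e′ x-y x-y′ , parallel-end-outside e≢e′ (Joins-sym x-y) (Joins-sym x-y′)
      where
      x-y : Joins e (src G e) (tgt G e)
      x-y = inj₁ (refl , refl)
      x-y′ : Joins e′ (src G e) (tgt G e)
      x-y′ = Parallel⇒Joins parallel

proposition12 : (G : Graph) → Connected G → Cubic G → ¬ HasPerfectMatching G →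
    (X : Subset (n G)) → MinimalGood G X → VeryGood G X
proposition12 G _ cubic _ X minimal-good =
  proj₁ minimal-good , loop-end-outside G cubic minimal-good , parallel-ends-outside G cubic minimal-good
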